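{- Let $G\in\varepsilon_{03}$ and let $C,C'$ be two cycles of $G$ whose intersection is a path $P_t$ with $t>0$ edges. If both $C,C'$ are of type $0$, or one is of type $0$ and the other of type $3$, then $t$ is even. If both are of type $3$, then $t$ is odd.
   Context: All graphs are finite, simple and connected. An Euler graph is a connected graph all of whose nodes have even degree. A cycle of length $n$ is of type $i$ if $n\equiv i\pmod 4$. $\varepsilon_{03}$ is the class of Euler graphs in which every cycle has length $\equiv 0$ or $\equiv 3\pmod 4$ and which contain at least one cycle of each of the types $0$ and $3$. -}

module Defs where

open import Data.Nat using (ℕ; zero; suc; _+_; _%_; _<_)
open import Data.Nat.DivMod using (m%n<n)
open import Data.Fin using (Fin; toℕ; fromℕ<; inject₁) renaming (suc to fsuc)
open import Data.Bool using (Bool; true; false; if_then_else_)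
open import Data.List using (List; map)
open import Data.Nat.ListAction using (sum)
open import Data.Fin.Base using ()
open import Data.List.Base using ()
open import Data.Product using (Σ; ∃; ∃-syntax; _×_; _,_)
open import Data.Sum using (_⊎_)
open import Relation.Binary.PropositionalEquality using (_≡_)
open import Relation.Binary.Construct.Closure.ReflexiveTransitive using (Star)
open import Function.Definitions using (Injective)
open import Function.Bundles using (_⇔_)
import Data.List as L
open import Data.Fin.Base as F using ()

record Graph (n : ℕ) : Set where
  field
    adj   : Fin n → Fin n → Bool
    sym   : ∀ u v → adj u v ≡ adj v u
    irrefl : ∀ v → adj v v ≡ false
open Graph public

Adj : ∀ {n} → Graph n → Fin n → Fin n → Set
Adj G u v = adj G u v ≡ true

allVertices : ∀ n → List (Fin n)
allVertices n = L.allFin n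

degree : ∀ {n} → Graph n → Fin n → ℕ
degree {n} G v = sum (map (λ u → if adj G v u then 1 else 0) (allVertices n))

Connected : ∀ {n} → Graph n → Set
Connected G = ∀ u v → Star (Adj G) u v

Euler : ∀ {n} → Graph n → Set
Euler G = Connected G × (∀ v → degree G v % 2 ≡ 0)

next : ∀ {m} → Fin (suc m) → Fin (suc m)
next {m} i = fromℕ< (m%n<n (suc (toℕ i)) (suc m))

record Cycle {n : ℕ} (G : Graph n) : Set where
  field
    m    : ℕ
    vert : Fin (3 + m) → Fin n
    inj  : Injective _≡_ _≡_ vert
    edge : ∀ i → Adj G (vert i) (vert (next i))
open Cycle public

len : ∀ {n} {G : Graph n} → Cycle G → ℕ
len C = 3 + m C

type : ∀ {n} {G : Graph n} → Cycle G → ℕ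
type C = len C % 4

OnV : ∀ {n} {G : Graph n} → Cycle G → Fin n → Set
OnV C v = ∃[ i ] vert C i ≡ v

OnE : ∀ {n} {G : Graph n} → Cycle G → Fin n → Fin n → Set
OnE C u v = ∃[ i ] ((vert C i ≡ u × vert C (next i) ≡ v) ⊎ (vert C i ≡ v × vert C (next i) ≡ u))

Eps03 : ∀ {n} → Graph n → Set
Eps03 G = Euler G
        × (∀ (C : Cycle G) → type C ≡ 0 ⊎ type C ≡ 3)
        × (∃[ C ] type {G = G} C ≡ 0)
        × (∃[ C ] type {G = G} C ≡ 3)

IntersectionIsPath : ∀ {n} {G : Graph n} → Cycle G → Cycle G → ℕ → Set
IntersectionIsPath {n} C C' t =
  Σ (Fin (suc t) → Fin n) λ w →
      Injective _≡_ _≡_ w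
    × (∀ v → (OnV C v × OnV C' v) ⇔ (∃[ j ] w j ≡ v))
    × (∀ u v → (OnE C u v × OnE C' u v) ⇔
         (∃[ j ] ((w (inject₁ j) ≡ u × w (fsuc j) ≡ v) ⊎ (w (inject₁ j) ≡ v × w (fsuc j) ≡ u))))

-- If C and C′ meet exactly in a path P with t > 0 edges, the two arcs C − P and C′ − P
-- share only the endpoints of P, so together they form a cycle D with
-- len D + 2t = len C + len C′.  In ε₀₃ every cycle, in particular D, has length ≡ 0 or 3
-- (mod 4); since 2t ≡ 0 or 2 (mod 4) according to the parity of t, the types of C and C′
-- then determine that parity.
-- To build D, each cycle is walked once around starting along P (C′ in the reverse
-- direction): consecutive vertices of P occupy positions differing by a constant ±1 on the
-- cycle, and the walks from the far end of P back to its start are concatenated.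

module Submission where

open import Defs hiding (sym)
open import Data.Nat using (ℕ; _/_; zero; suc; _+_; _*_; _∸_; _%_; _<_; _≤_; z≤n; s≤s; z<s; _<?_; pred; >-nonZero)
open import Data.Nat.Properties
open import Data.Nat.DivMod
open import Data.Nat.Tactic.RingSolver using (solve-∀)
open import Data.Fin using (Fin; toℕ; fromℕ<; inject₁) renaming (suc to fsuc)
open import Data.Fin.Properties using (toℕ-injective; toℕ-inject₁; toℕ≤pred[n]; fromℕ<-cong; fromℕ<-toℕ; toℕ-fromℕ<; toℕ<n)
open import Data.Product using (Σ; _×_; _,_; proj₁; proj₂)
open import Data.Sum using (_⊎_; inj₁; inj₂)
open import Function.Bundles using (Equivalence)
open import Data.Empty using (⊥; ⊥-elim)
open import Relation.Binary.PropositionalEquality using (_≡_; refl; sym; trans; cong; cong₂; subst; subst₂; module ≡-Reasoning)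
open import Relation.Nullary using (yes; no)

-- Arithmetic modulo k = K + 1

data Orientation : Set where
  forward backward : Orientation

flip : Orientation → Orientation
flip forward = backward
flip backward = forward

module Modulo (K : ℕ) where

  k : ℕ
  k = suc K

  %-cong-+ʳ : ∀ x y z → x % k ≡ y % k → (x + z) % k ≡ (y + z) % k
  %-cong-+ʳ x y z e = begin
    (x + z) % k               ≡⟨ %-distribˡ-+ x z k ⟩
    (x % k + z % k) % k       ≡⟨ cong (λ u → (u + z % k) % k) e ⟩
    (y % k + z % k) % k       ≡⟨ %-distribˡ-+ y z k ⟨
    (y + z) % k               ∎
    where open ≡-Reasoning

  %-+-%ʳ : ∀ z x → (z + x % k) % k ≡ (z + x) % k
  %-+-%ʳ z x = begin
    (z + x % k) % k   ≡⟨ cong (_% k) (+-comm z (x % k)) ⟩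
    (x % k + z) % k   ≡⟨ %-cong-+ʳ (x % k) x z (m%n%n≡m%n x k) ⟩
    (x + z) % k       ≡⟨ cong (_% k) (+-comm x z) ⟩
    (z + x) % k       ∎
    where open ≡-Reasoning

  -- Adding x·K to a + x yields a + x·k, which is how x is cancelled.
  %-cancel-+ʳ : ∀ x a b → (a + x) % k ≡ (b + x) % k → a % k ≡ b % k
  %-cancel-+ʳ x a b e = begin
    a % k                  ≡⟨ [m+kn]%n≡m%n a x k ⟨
    (a + x * k) % k        ≡⟨ cong (_% k) (shift x K a) ⟩
    (a + x + x * K) % k    ≡⟨ %-cong-+ʳ (a + x) (b + x) (x * K) e ⟩
    (b + x + x * K) % k    ≡⟨ cong (_% k) (shift x K b) ⟨
    (b + x * k) % k        ≡⟨ [m+kn]%n≡m%n b x k ⟩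
    b % k                  ∎
    where
    open ≡-Reasoning
    shift : ∀ x K a → a + x * suc K ≡ a + x + x * K
    shift = solve-∀

  -- K ≡ −1 modulo k, via a·K + (a + b) = b + a·k.
  %-cancel-*K : ∀ a b → (a * K) % k ≡ (b * K) % k → a % k ≡ b % k
  %-cancel-*K a b e = begin
    a % k                   ≡⟨ [m+kn]%n≡m%n a b k ⟨
    (a + b * k) % k         ≡⟨ cong (_% k) (shift K b a) ⟩
    (b * K + (b + a)) % k   ≡⟨ %-cong-+ʳ (b * K) (a * K) (b + a) (sym e) ⟩
    (a * K + (b + a)) % k   ≡⟨ cong (λ u → (a * K + u) % k) (+-comm b a) ⟩
    (a * K + (a + b)) % k   ≡⟨ cong (_% k) (shift K a b) ⟨
    (b + a * k) % k         ≡⟨ [m+kn]%n≡m%n b a k ⟩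
    b % k                   ∎
    where
    open ≡-Reasoning
    shift : ∀ K a b → b + a * suc K ≡ a * K + (a + b)
    shift = solve-∀

  %-injective-< : ∀ {a b} → a < k → b < k → a % k ≡ b % k → a ≡ b
  %-injective-< a<k b<k e = trans (sym (m<n⇒m%n≡m a<k)) (trans e (m<n⇒m%n≡m b<k))

  -- One step along a cycle of length k moves the position by 1 or by K ≡ −1.
  stride : Orientation → ℕ
  stride forward = 1
  stride backward = K

  stride-flip : ∀ o → stride (flip o) + stride o ≡ k
  stride-flip forward = +-comm K 1
  stride-flip backward = refl

  %-cancel-*stride : ∀ o a b → (a * stride o) % k ≡ (b * stride o) % k → a % k ≡ b % k
  %-cancel-*stride forward a b e = subst₂ (λ x y → x % k ≡ y % k) (*-identityʳ a) (*-identityʳ b) e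
  %-cancel-*stride backward a b e = %-cancel-*K a b e

swapE : ∀ {n} {G : Graph n} (C : Cycle G) {u v} → OnE C u v → OnE C v u
swapE C (i , inj₁ e) = i , inj₂ e
swapE C (i , inj₂ e) = i , inj₁ e

module CyclicIndexing {n} {G : Graph n} (C : Cycle G) where
  open Modulo (2 + m C) public

  at : ℕ → Fin n
  at i = vert C (fromℕ< (m%n<n i k))

  at-cong-% : ∀ a b → a % k ≡ b % k → at a ≡ at b
  at-cong-% a b e = cong (vert C) (fromℕ<-cong _ _ e _ _)

  at-k+ : ∀ x → at (k + x) ≡ at x
  at-k+ x = at-cong-% (k + x) x (trans (cong (_% k) (+-comm k x)) ([m+n]%n≡m%n x k))

  at-injective : ∀ a b → at a ≡ at b → a % k ≡ b % k
  at-injective a b e = trans (sym (toℕ-fromℕ< (m%n<n a k))) (trans (cong toℕ (inj C e)) (toℕ-fromℕ< (m%n<n b k)))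

  at-onV : ∀ i → OnV C (at i)
  at-onV i = _ , refl

  at-onE : ∀ i → OnE C (at i) (at (suc i))
  at-onE i = fromℕ< (m%n<n i k) , inj₁ (refl , at-cong-% (suc (toℕ (fromℕ< (m%n<n i k)))) (suc i) next-%)
    where
    next-% : suc (toℕ (fromℕ< (m%n<n i k))) % k ≡ suc i % k
    next-% = trans (cong (λ x → suc x % k) (toℕ-fromℕ< (m%n<n i k))) (%-+-%ʳ 1 i)

  at-toℕ : ∀ I → at (toℕ I) ≡ vert C I
  at-toℕ I = cong (vert C) (trans (fromℕ<-cong _ _ (m<n⇒m%n≡m (toℕ<n I)) _ (toℕ<n I)) (fromℕ<-toℕ I _))

  onV⇒at : ∀ {v} → OnV C v → Σ ℕ λ i → i < k × at i ≡ v
  onV⇒at (I , e) = toℕ I , toℕ<n I , trans (at-toℕ I) e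

  onE⇒at : ∀ {u v} → OnE C u v →
    Σ ℕ λ i → i < k × ((at i ≡ u × at (suc i) ≡ v) ⊎ (at i ≡ v × at (suc i) ≡ u))
  onE⇒at (I , inj₁ (a , b)) = toℕ I , toℕ<n I , inj₁ (trans (at-toℕ I) a , b)
  onE⇒at (I , inj₂ (a , b)) = toℕ I , toℕ<n I , inj₂ (trans (at-toℕ I) a , b)

  at-stride : ∀ o x → OnE C (at x) (at (stride o + x))
  at-stride forward x = at-onE x
  at-stride backward x = swapE C (subst (OnE C (at (stride backward + x))) (at-k+ x) (at-onE (stride backward + x)))

-- Walking once around a cycle along a path

record IsPathOn {n} {G : Graph n} (C : Cycle G) (V : ℕ → Fin n) (t : ℕ) : Set where
  field
    onV : ∀ j → OnV C (V j)
    onE : ∀ j → j < t → OnE C (V j) (V (suc j))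
    injective : ∀ i j → i ≤ t → j ≤ t → V i ≡ V j → i ≡ j

record Tour {n} {G : Graph n} (C : Cycle G) (V : ℕ → Fin n) (t : ℕ) : Set where
  field
    walk : ℕ → Fin n
    walk-onV : ∀ i → OnV C (walk i)
    walk-onE : ∀ i → OnE C (walk i) (walk (suc i))
    walk-injective : ∀ a b → a < len C → b < len C → walk a ≡ walk b → a ≡ b
    walk-closed : walk (len C) ≡ walk 0
    walk-extends : ∀ j → j ≤ t → walk j ≡ V j

module _ {n} {G : Graph n} (C : Cycle G) {V : ℕ → Fin n} {t : ℕ} (path : IsPathOn C V t) where
  open CyclicIndexing C
  open IsPathOn path

  private
    pos : ℕ → ℕ
    pos j = proj₁ (onV⇒at (onV j))

    pos<k : ∀ j → pos j < k
    pos<k j = proj₁ (proj₂ (onV⇒at (onV j)))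

    at-pos : ∀ j → at (pos j) ≡ V j
    at-pos j = proj₂ (proj₂ (onV⇒at (onV j)))

    pos-% : ∀ j → pos j % k ≡ pos j
    pos-% j = m<n⇒m%n≡m (pos<k j)

    pos-at : ∀ i j → at i ≡ V j → pos j ≡ i % k
    pos-at i j e = trans (sym (pos-% j)) (at-injective (pos j) i (trans (at-pos j) (sym e)))

    Step : Orientation → ℕ → Set
    Step o j = pos (suc j) ≡ (stride o + pos j) % k

    step : ∀ j → j < t → Σ Orientation λ o → Step o j
    step j j<t with onE⇒at (onE j j<t)
    ... | i , i<k , inj₁ (ej , esj) = forward , (begin
      pos (suc j)         ≡⟨ pos-at (suc i) (suc j) esj ⟩
      suc i % k           ≡⟨ cong (λ x → suc x % k) (trans (pos-at i j ej) (m<n⇒m%n≡m i<k)) ⟨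
      suc (pos j) % k     ∎)
      where open ≡-Reasoning
    ... | i , i<k , inj₂ (esj , ej) = backward , (begin
      pos (suc j)                       ≡⟨ pos-at i (suc j) esj ⟩
      i % k                             ≡⟨ [m+n]%n≡m%n i k ⟨
      (i + k) % k                       ≡⟨ cong (_% k) (trans (+-comm i k) (sym (+-suc (stride backward) i))) ⟩
      (stride backward + suc i) % k     ≡⟨ %-+-%ʳ (stride backward) (suc i) ⟨
      (stride backward + suc i % k) % k ≡⟨ cong (λ x → (stride backward + x) % k) (pos-at (suc i) j ej) ⟨
      (stride backward + pos j) % k     ∎)
      where open ≡-Reasoning

    pos-injective : ∀ i j → i ≤ t → j ≤ t → pos i ≡ pos j → i ≡ j
    pos-injective i j i≤t j≤t e = injective i j i≤t j≤t (trans (sym (at-pos i)) (trans (cong at e) (at-pos j)))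

    -- Two opposite steps would return the path to a vertex it already visited.
    no-turning-back : ∀ o j → 2 + j ≤ t → Step o j → Step (flip o) (suc j) → ⊥
    no-turning-back o j 2+j≤t s s′ =
      <⇒≢ (m<n+m j {2} z<s) (sym (pos-injective (2 + j) j 2+j≤t (≤-trans (m≤n+m j 2) 2+j≤t) returns))
      where
      open ≡-Reasoning
      returns : pos (2 + j) ≡ pos j
      returns = begin
        pos (2 + j)                                        ≡⟨ s′ ⟩
        (stride (flip o) + pos (suc j)) % k                ≡⟨ cong (λ x → (stride (flip o) + x) % k) s ⟩
        (stride (flip o) + (stride o + pos j) % k) % k     ≡⟨ %-+-%ʳ (stride (flip o)) (stride o + pos j) ⟩
        (stride (flip o) + (stride o + pos j)) % k         ≡⟨ cong (_% k) (+-assoc (stride (flip o)) (stride o) (pos j)) ⟨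
        (stride (flip o) + stride o + pos j) % k           ≡⟨ cong (λ x → (x + pos j) % k) (stride-flip o) ⟩
        (k + pos j) % k                                    ≡⟨ cong (_% k) (+-comm k (pos j)) ⟩
        (pos j + k) % k                                    ≡⟨ [m+n]%n≡m%n (pos j) k ⟩
        pos j % k                                          ≡⟨ pos-% j ⟩
        pos j                                              ∎

    keep-orientation : ∀ o o′ j → 2 + j ≤ t → Step o j → Step o′ (suc j) → Step o (suc j)
    keep-orientation forward  forward  j _ _ s′ = s′
    keep-orientation backward backward j _ _ s′ = s′
    keep-orientation forward  backward j 2+j≤t s s′ = ⊥-elim (no-turning-back forward j 2+j≤t s s′)
    keep-orientation backward forward  j 2+j≤t s s′ = ⊥-elim (no-turning-back backward j 2+j≤t s s′)

    steps-along : ∀ o → Step o 0 → ∀ j → j < t → Step o j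
    steps-along o s₀ zero    _      = s₀
    steps-along o s₀ (suc j) 1+j<t =
      keep-orientation o (proj₁ s) j 1+j<t (steps-along o s₀ j (≤-trans (n≤1+n (suc j)) 1+j<t)) (proj₂ s)
      where
      s : Σ Orientation λ o′ → Step o′ (suc j)
      s = step (suc j) 1+j<t

    position : ∀ o → (∀ j → j < t → Step o j) → ∀ j → j ≤ t → pos j ≡ (j * stride o + pos 0) % k
    position o steps zero    _     = sym (pos-% 0)
    position o steps (suc j) 1+j≤t = begin
      pos (suc j)                                   ≡⟨ steps j 1+j≤t ⟩
      (stride o + pos j) % k                        ≡⟨ cong (λ x → (stride o + x) % k) (position o steps j (≤-trans (n≤1+n j) 1+j≤t)) ⟩
      (stride o + (j * stride o + pos 0) % k) % k   ≡⟨ %-+-%ʳ (stride o) (j * stride o + pos 0) ⟩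
      (stride o + (j * stride o + pos 0)) % k       ≡⟨ cong (_% k) (+-assoc (stride o) (j * stride o) (pos 0)) ⟨
      (suc j * stride o + pos 0) % k                ∎
      where open ≡-Reasoning

    oriented-tour : ∀ o → (∀ j → j < t → Step o j) → Tour C V t
    oriented-tour o steps = record
      { walk = walk
      ; walk-onV = λ i → at-onV (i * s + pos 0)
      ; walk-onE = λ i → subst (λ x → OnE C (walk i) (at x)) (sym (+-assoc s (i * s) (pos 0))) (at-stride o (i * s + pos 0))
      ; walk-injective = λ a b a<k b<k e → %-injective-< a<k b<k (%-cancel-*stride o a b
          (%-cancel-+ʳ (pos 0) (a * s) (b * s) (at-injective (a * s + pos 0) (b * s + pos 0) e)))
      ; walk-closed = at-cong-% (k * s + pos 0) (pos 0) (trans (cong (_% k) full-turn) ([m+kn]%n≡m%n (pos 0) s k))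
      ; walk-extends = λ j j≤t → trans (at-cong-% (j * s + pos 0) (pos j) (trans (sym (m%n%n≡m%n (j * s + pos 0) k))
          (cong (_% k) (sym (position o steps j j≤t))))) (at-pos j)
      }
      where
      s : ℕ
      s = stride o
      walk : ℕ → Fin n
      walk i = at (i * s + pos 0)
      full-turn : k * s + pos 0 ≡ pos 0 + s * k
      full-turn = trans (+-comm (k * s) (pos 0)) (cong (pos 0 +_) (*-comm k s))

  tour : 0 < t → Tour C V t
  tour 0<t = oriented-tour (proj₁ s₀) (steps-along (proj₁ s₀) (proj₂ s₀))
    where
    s₀ : Σ Orientation λ o → Step o 0
    s₀ = step 0 0<t

onE⇒Adj : ∀ {n} {G : Graph n} (C : Cycle G) {u v} → OnE C u v → Adj G u v
onE⇒Adj {G = G} C     (i , inj₁ (eu , ev)) = subst₂ (Adj G) eu ev (edge C i)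
onE⇒Adj {G = G} C {u} (i , inj₂ (ev , eu)) = trans (Graph.sym G u _) (subst₂ (Adj G) ev eu (edge C i))

reverse-path : ∀ {n} {G : Graph n} {C : Cycle G} {V : ℕ → Fin n} {t} →
  IsPathOn C V t → IsPathOn C (λ j → V (t ∸ j)) t
reverse-path {C = C} {V} {t} path = record
  { onV = λ j → onV (t ∸ j)
  ; onE = λ j j<t → subst (λ i → OnE C (V i) (V (t ∸ suc j))) (sym (+-∸-assoc 1 j<t))
                      (swapE C (onE (t ∸ suc j) (∸-monoʳ-< {o = 0} z<s j<t)))
  ; injective = λ i j i≤t j≤t e → ∸-cancelˡ-≡ i≤t j≤t (injective (t ∸ i) (t ∸ j) (m∸n≤m t i) (m∸n≤m t j) e)
  }
  where open IsPathOn path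

tour-longer : ∀ {n} {G : Graph n} {C : Cycle G} {V : ℕ → Fin n} {t} → IsPathOn C V t → Tour C V t → t < len C
tour-longer {C = C} {V} {t} path T = ≰⇒> λ k≤t → 0≢1+n (sym (injective (len C) 0 k≤t z≤n (V-k≡V-0 k≤t)))
  where
  open IsPathOn path
  open Tour T
  V-k≡V-0 : len C ≤ t → V (len C) ≡ V 0
  V-k≡V-0 k≤t = trans (sym (walk-extends (len C) k≤t)) (trans walk-closed (walk-extends 0 z≤n))

cycle-from-walk : ∀ {n} {G : Graph n} (m′ : ℕ) (h : ℕ → Fin n) →
  (∀ i j → i < 3 + m′ → j < 3 + m′ → h i ≡ h j → i ≡ j) →
  (∀ i → suc i < 3 + m′ → Adj G (h i) (h (suc i))) →
  Adj G (h (2 + m′)) (h 0) → Cycle G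
cycle-from-walk {G = G} m′ h h-injective h-edge h-closing = record
  { m = m′
  ; vert = λ i → h (toℕ i)
  ; inj = λ {i} {j} e → toℕ-injective (h-injective _ _ (toℕ<n i) (toℕ<n j) e)
  ; edge = λ i → subst (λ x → Adj G (h (toℕ i)) (h x)) (sym (toℕ-fromℕ< _)) (edge-mod (toℕ i) (toℕ<n i))
  }
  where
  L : ℕ
  L = 3 + m′
  edge-mod : ∀ i → i < L → Adj G (h i) (h (suc i % L))
  edge-mod i i<L with suc i <? L
  ... | yes 1+i<L = subst (λ x → Adj G (h i) (h x)) (sym (m<n⇒m%n≡m 1+i<L)) (h-edge i 1+i<L)
  ... | no  1+i≮L = subst₂ (λ x y → Adj G (h x) (h y)) (sym (suc-injective 1+i≡L))
                      (sym (trans (cong (_% L) 1+i≡L) (n%n≡0 L))) h-closing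
    where
    1+i≡L : suc i ≡ L
    1+i≡L = ≤-antisym i<L (≮⇒≥ 1+i≮L)

-- The cycle formed by the two arcs outside the common path

record MeetAlong {n} {G : Graph n} (C C′ : Cycle G) (W : ℕ → Fin n) (t : ℕ) : Set where
  field
    path  : IsPathOn C W t
    path′ : IsPathOn C′ W t
    common-vertex : ∀ {v} → OnV C v → OnV C′ v → Σ ℕ λ q → q ≤ t × W q ≡ v
    common-edge : ∀ {u v} → OnE C u v → OnE C′ u v →
      Σ ℕ λ j → j < t × ((W j ≡ u × W (suc j) ≡ v) ⊎ (W j ≡ v × W (suc j) ≡ u))

3≤m+n : ∀ {a b} → 0 < a → 0 < b → (a ≡ 1 → b ≡ 1 → ⊥) → 3 ≤ a + b
3≤m+n {suc zero}    {suc zero}    _ _ not-both = ⊥-elim (not-both refl refl)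
3≤m+n {suc zero}    {suc (suc b)} _ _ _        = s≤s (s≤s (s≤s z≤n))
3≤m+n {suc (suc a)} {suc b}       _ _ _        = s≤s (s≤s (≤-trans (s≤s z≤n) (m≤n+m (suc b) a)))

module Splice {n} {G : Graph n} {C C′ : Cycle G} {W : ℕ → Fin n} {t : ℕ} (0<t : 0 < t)
  (meet : MeetAlong C C′ W t) where
  open MeetAlong meet
  open IsPathOn path using () renaming (injective to W-injective)

  private
    T : Tour C W t
    T = tour C path 0<t
    T′ : Tour C′ (λ j → W (t ∸ j)) t
    T′ = tour C′ (reverse-path path′) 0<t

  open Tour T
  open Tour T′ using () renaming (walk to walk′; walk-onV to walk′-onV; walk-onE to walk′-onE;
    walk-injective to walk′-injective; walk-closed to walk′-closed; walk-extends to walk′-extends)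

  k k′ : ℕ
  k  = len C
  k′ = len C′

  walk-t : walk t ≡ W t
  walk-t = walk-extends t ≤-refl

  walk-k : walk k ≡ W 0
  walk-k = trans walk-closed (walk-extends 0 z≤n)

  walk′-t : walk′ t ≡ W 0
  walk′-t = trans (walk′-extends t ≤-refl) (cong W (n∸n≡0 t))

  walk′-k′ : walk′ k′ ≡ W t
  walk′-k′ = trans walk′-closed (walk′-extends 0 z≤n)

  a b : ℕ
  a = k ∸ t
  b = k′ ∸ t

  t<k : t < k
  t<k = tour-longer path T

  t<k′ : t < k′
  t<k′ = tour-longer (reverse-path path′) T′

  t+a≡k : t + a ≡ k
  t+a≡k = m+[n∸m]≡n (<⇒≤ t<k)

  t+b≡k′ : t + b ≡ k′
  t+b≡k′ = m+[n∸m]≡n (<⇒≤ t<k′)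

  0<a : 0 < a
  0<a = m<n⇒0<n∸m t<k

  0<b : 0 < b
  0<b = m<n⇒0<n∸m t<k′

  -- Otherwise the edge {W t, W 0} would lie on both cycles but not on the path.
  arcs-not-both-single-edges : a ≡ 1 → b ≡ 1 → ⊥
  arcs-not-both-single-edges a≡1 b≡1 with common-edge closing closing′
    where
    1+t≡k : suc t ≡ k
    1+t≡k = trans (+-comm 1 t) (trans (cong (t +_) (sym a≡1)) t+a≡k)
    1+t≡k′ : suc t ≡ k′
    1+t≡k′ = trans (+-comm 1 t) (trans (cong (t +_) (sym b≡1)) t+b≡k′)
    closing : OnE C (W t) (W 0)
    closing = subst₂ (OnE C) walk-t (trans (cong walk 1+t≡k) walk-k) (walk-onE t)
    closing′ : OnE C′ (W t) (W 0)
    closing′ = swapE C′ (subst₂ (OnE C′) walk′-t (trans (cong walk′ 1+t≡k′) walk′-k′) (walk′-onE t))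
  ... | j , j<t , inj₁ (Wj≡Wt , _) = <⇒≢ j<t (W-injective j t (<⇒≤ j<t) ≤-refl Wj≡Wt)
  ... | j , j<t , inj₂ (Wj≡W0 , W1+j≡Wt) = k≢2 (begin
    k          ≡⟨ t+a≡k ⟨
    t + a      ≡⟨ cong₂ _+_ (sym (W-injective (suc j) t j<t ≤-refl W1+j≡Wt)) a≡1 ⟩
    suc j + 1  ≡⟨ cong (λ x → suc x + 1) (W-injective j 0 (<⇒≤ j<t) z≤n Wj≡W0) ⟩
    2          ∎)
    where
    open ≡-Reasoning
    k≢2 : k ≡ 2 → ⊥
    k≢2 ()

  m′ : ℕ
  m′ = a + b ∸ 3

  3+m′≡a+b : 3 + m′ ≡ a + b
  3+m′≡a+b = m+[n∸m]≡n (3≤m+n 0<a 0<b arcs-not-both-single-edges)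

  arc arc′ : ℕ → Fin n
  arc  i = walk (t + i)
  arc′ j = walk′ (t + j)

  arc-bound : ∀ {i} → i < a → t + i < k
  arc-bound {i} i<a = subst (t + i <_) t+a≡k (+-monoʳ-< t i<a)

  arc′-bound : ∀ {j} → j < b → t + j < k′
  arc′-bound {j} j<b = subst (t + j <_) t+b≡k′ (+-monoʳ-< t j<b)

  arc-adj : ∀ i → Adj G (arc i) (arc (suc i))
  arc-adj i = subst (λ x → Adj G (arc i) (walk x)) (sym (+-suc t i)) (onE⇒Adj C (walk-onE (t + i)))

  arc′-adj : ∀ j → Adj G (arc′ j) (arc′ (suc j))
  arc′-adj j = subst (λ x → Adj G (arc′ j) (walk′ x)) (sym (+-suc t j)) (onE⇒Adj C′ (walk′-onE (t + j)))

  arc-end : arc a ≡ arc′ 0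
  arc-end = trans (cong walk t+a≡k) (trans walk-k (trans (sym walk′-t) (cong walk′ (sym (+-identityʳ t)))))

  arc′-end : arc′ b ≡ arc 0
  arc′-end = trans (cong walk′ t+b≡k′) (trans walk′-k′ (trans (sym walk-t) (cong walk (sym (+-identityʳ t)))))

  -- A vertex on both arcs is some W q; on C this forces q = t with i = 0, and then on C′ it forces t = 0.
  arcs-disjoint : ∀ {i j} → i < a → j < b → arc i ≡ arc′ j → ⊥
  arcs-disjoint {i} {j} i<a j<b e with common-vertex (walk-onV (t + i)) (subst (OnV C′) (sym e) (walk′-onV (t + j)))
  ... | q , q≤t , Wq≡arc-i = <⇒≢ 0<t (sym (m+n≡0⇒m≡0 t t+j≡0))
    where
    q≡t+i : q ≡ t + i
    q≡t+i = walk-injective q (t + i) (≤-<-trans q≤t t<k) (arc-bound i<a)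
              (trans (walk-extends q q≤t) Wq≡arc-i)
    q≡t : q ≡ t
    q≡t = ≤-antisym q≤t (subst (t ≤_) (sym q≡t+i) (m≤m+n t i))
    t+j≡0 : t + j ≡ 0
    t+j≡0 = walk′-injective (t + j) 0 (arc′-bound j<b) (≤-<-trans z≤n t<k′)
              (trans (sym e) (trans (sym Wq≡arc-i) (trans (cong W q≡t) (sym (walk′-extends 0 z≤n)))))

  d : ℕ → Fin n
  d i with i <? a
  ... | yes _ = arc i
  ... | no  _ = arc′ (i ∸ a)

  d-arc : ∀ {i} → i < a → d i ≡ arc i
  d-arc {i} i<a with i <? a
  ... | yes _   = refl
  ... | no  i≮a = ⊥-elim (i≮a i<a)

  d-arc′ : ∀ j → d (a + j) ≡ arc′ j
  d-arc′ j with a + j <? a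
  ... | yes a+j<a = ⊥-elim (m+n≮m a j a+j<a)
  ... | no  _     = cong arc′ (m+n∸m≡n a j)

  side : ∀ i → i < 3 + m′ → i < a ⊎ Σ ℕ λ j → j < b × i ≡ a + j
  side i i<3+m′ with i <? a
  ... | yes i<a = inj₁ i<a
  ... | no  i≮a = inj₂ (i ∸ a , j<b , sym (m+[n∸m]≡n (≮⇒≥ i≮a)))
    where
    j<b : i ∸ a < b
    j<b = subst (i ∸ a <_) (m+n∸m≡n a b) (∸-monoˡ-< (subst (i <_) 3+m′≡a+b i<3+m′) (≮⇒≥ i≮a))

  d-injective : ∀ i j → i < 3 + m′ → j < 3 + m′ → d i ≡ d j → i ≡ j
  d-injective i j i< j< e with side i i< | side j j<
  ... | inj₁ i<a | inj₁ j<a =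
    +-cancelˡ-≡ t i j (walk-injective (t + i) (t + j) (arc-bound i<a) (arc-bound j<a)
      (trans (sym (d-arc i<a)) (trans e (d-arc j<a))))
  ... | inj₁ i<a | inj₂ (j′ , j′<b , refl) =
    ⊥-elim (arcs-disjoint i<a j′<b (trans (sym (d-arc i<a)) (trans e (d-arc′ j′))))
  ... | inj₂ (i′ , i′<b , refl) | inj₁ j<a =
    ⊥-elim (arcs-disjoint j<a i′<b (trans (sym (d-arc j<a)) (trans (sym e) (d-arc′ i′))))
  ... | inj₂ (i′ , i′<b , refl) | inj₂ (j′ , j′<b , refl) =
    cong (a +_) (+-cancelˡ-≡ t i′ j′ (walk′-injective (t + i′) (t + j′) (arc′-bound i′<b) (arc′-bound j′<b)
      (trans (sym (d-arc′ i′)) (trans e (d-arc′ j′)))))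

  d-adj : ∀ i → suc i < 3 + m′ → Adj G (d i) (d (suc i))
  d-adj i 1+i< with side (suc i) 1+i<
  ... | inj₁ 1+i<a = subst₂ (Adj G) (sym (d-arc (<-trans (n<1+n i) 1+i<a))) (sym (d-arc 1+i<a)) (arc-adj i)
  ... | inj₂ (zero , _ , 1+i≡a+0) = subst₂ (Adj G) (sym (d-arc i<a)) arc-1+i≡d-1+i (arc-adj i)
    where
    1+i≡a : suc i ≡ a
    1+i≡a = trans 1+i≡a+0 (+-identityʳ a)
    i<a : i < a
    i<a = subst (i <_) 1+i≡a (n<1+n i)
    arc-1+i≡d-1+i : arc (suc i) ≡ d (suc i)
    arc-1+i≡d-1+i = trans (cong arc 1+i≡a) (trans arc-end (sym (trans (cong d 1+i≡a+0) (d-arc′ 0))))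
  ... | inj₂ (suc j , _ , 1+i≡a+1+j) =
    subst₂ (Adj G) (sym (trans (cong d i≡a+j) (d-arc′ j))) (sym (trans (cong d 1+i≡a+1+j) (d-arc′ (suc j))))
      (arc′-adj j)
    where
    i≡a+j : i ≡ a + j
    i≡a+j = suc-injective (trans 1+i≡a+1+j (+-suc a j))

  d-closing : Adj G (d (2 + m′)) (d 0)
  d-closing = subst₂ (Adj G) (sym (trans (cong d 2+m′≡a+b₁) (d-arc′ b₁)))
    (trans (cong arc′ 1+b₁≡b) (trans arc′-end (sym (d-arc 0<a)))) (arc′-adj b₁)
    where
    b₁ : ℕ
    b₁ = pred b
    1+b₁≡b : suc b₁ ≡ b
    1+b₁≡b = suc-pred b {{>-nonZero 0<b}}
    2+m′≡a+b₁ : 2 + m′ ≡ a + b₁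
    2+m′≡a+b₁ = suc-injective (trans 3+m′≡a+b (trans (cong (a +_) (sym 1+b₁≡b)) (+-suc a b₁)))

  D : Cycle G
  D = cycle-from-walk m′ d d-injective d-adj d-closing

  len-D : len D + (t + t) ≡ len C + len C′
  len-D = trans (cong (_+ (t + t)) 3+m′≡a+b) (trans (rearrange a b t) (cong₂ _+_ t+a≡k t+b≡k′))
    where
    rearrange : ∀ a b t → a + b + (t + t) ≡ (t + a) + (t + b)
    rearrange = solve-∀

intersection-meet : ∀ {n} {G : Graph n} {C C′ : Cycle G} {t} → IntersectionIsPath C C′ t →
  Σ (ℕ → Fin n) λ W → MeetAlong C C′ W t
intersection-meet {C = C} {C′} {t} (w , w-injective , vertices , edges) = W , record
  { path  = record { onV = λ j → proj₁ (on-both j) ; onE = λ j j<t → proj₁ (edge-on-both j j<t) ; injective = W-injective }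
  ; path′ = record { onV = λ j → proj₂ (on-both j) ; onE = λ j j<t → proj₂ (edge-on-both j j<t) ; injective = W-injective }
  ; common-vertex = common-vertex
  ; common-edge = common-edge
  }
  where
  -- Beyond t the path stays at its endpoint, which makes it total on ℕ.
  clamp : ℕ → Fin (suc t)
  clamp j = fromℕ< (s≤s (m⊓n≤n j t))

  W : ℕ → Fin _
  W j = w (clamp j)

  toℕ-clamp : ∀ {j} → j ≤ t → toℕ (clamp j) ≡ j
  toℕ-clamp j≤t = trans (toℕ-fromℕ< _) (m≤n⇒m⊓n≡m j≤t)

  W-toℕ : ∀ J → W (toℕ J) ≡ w J
  W-toℕ J = cong w (toℕ-injective (toℕ-clamp (toℕ≤pred[n] J)))

  W-injective : ∀ i j → i ≤ t → j ≤ t → W i ≡ W j → i ≡ j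
  W-injective i j i≤t j≤t e = trans (sym (toℕ-clamp i≤t)) (trans (cong toℕ (w-injective e)) (toℕ-clamp j≤t))

  on-both : ∀ j → OnV C (W j) × OnV C′ (W j)
  on-both j = Equivalence.from (vertices (W j)) (clamp j , refl)

  edge-on-both : ∀ j → j < t → OnE C (W j) (W (suc j)) × OnE C′ (W j) (W (suc j))
  edge-on-both j j<t = Equivalence.from (edges (W j) (W (suc j))) (J , inj₁ (w-J≡W-j , w-1+J≡W-1+j))
    where
    J : Fin t
    J = fromℕ< j<t
    w-J≡W-j : w (inject₁ J) ≡ W j
    w-J≡W-j = trans (sym (W-toℕ (inject₁ J))) (cong W (trans (toℕ-inject₁ J) (toℕ-fromℕ< j<t)))
    w-1+J≡W-1+j : w (fsuc J) ≡ W (suc j)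
    w-1+J≡W-1+j = trans (sym (W-toℕ (fsuc J))) (cong (λ x → W (suc x)) (toℕ-fromℕ< j<t))

  common-vertex : ∀ {v} → OnV C v → OnV C′ v → Σ ℕ λ q → q ≤ t × W q ≡ v
  common-vertex {v} o o′ with Equivalence.to (vertices v) (o , o′)
  ... | J , wJ≡v = toℕ J , toℕ≤pred[n] J , trans (W-toℕ J) wJ≡v

  W-inject₁ : ∀ J → W (toℕ J) ≡ w (inject₁ J)
  W-inject₁ J = trans (cong W (sym (toℕ-inject₁ J))) (W-toℕ (inject₁ J))

  common-edge : ∀ {u v} → OnE C u v → OnE C′ u v →
    Σ ℕ λ j → j < t × ((W j ≡ u × W (suc j) ≡ v) ⊎ (W j ≡ v × W (suc j) ≡ u))
  common-edge {u} {v} o o′ with Equivalence.to (edges u v) (o , o′)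
  ... | J , inj₁ (e , e′) = toℕ J , toℕ<n J , inj₁ (trans (W-inject₁ J) e , trans (W-toℕ (fsuc J)) e′)
  ... | J , inj₂ (e , e′) = toℕ J , toℕ<n J , inj₂ (trans (W-inject₁ J) e , trans (W-toℕ (fsuc J)) e′)

symmetric-difference-cycle : ∀ {n} {G : Graph n} (C C′ : Cycle G) {t} → 0 < t → IntersectionIsPath C C′ t →
  Σ (Cycle G) λ D → len D + (t + t) ≡ len C + len C′
symmetric-difference-cycle C C′ {t} 0<t I = D , len-D
  where open Splice 0<t (proj₂ (intersection-meet {C = C} {C′} {t} I))

-- Parity

[m+m]%4≡[r+r]%4 : ∀ m → (m + m) % 4 ≡ (m % 2 + m % 2) % 4
[m+m]%4≡[r+r]%4 m = begin
  (m + m) % 4                          ≡⟨ cong (λ x → (x + x) % 4) (m≡m%n+[m/n]*n m 2) ⟩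
  ((r + q * 2) + (r + q * 2)) % 4      ≡⟨ cong (_% 4) (regroup r q) ⟩
  ((r + r) + q * 4) % 4                ≡⟨ [m+kn]%n≡m%n (r + r) q 4 ⟩
  (r + r) % 4                          ∎
  where
  open ≡-Reasoning
  r q : ℕ
  r = m % 2
  q = m / 2
  regroup : ∀ r q → (r + q * 2) + (r + q * 2) ≡ (r + r) + q * 4
  regroup = solve-∀

even-overlap : ∀ {x y z} r → r < 2 → (x ≡ 0 ⊎ x ≡ 3) → (x + (r + r)) % 4 ≡ (y + z) % 4 →
  (y ≡ 0 × z ≡ 0) ⊎ (y ≡ 0 × z ≡ 3) ⊎ (y ≡ 3 × z ≡ 0) → r ≡ 0
even-overlap zero          _                 _            _  _                             = refl
even-overlap (suc zero)    _                 (inj₁ refl)  () (inj₁ (refl , refl))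
even-overlap (suc zero)    _                 (inj₁ refl)  () (inj₂ (inj₁ (refl , refl)))
even-overlap (suc zero)    _                 (inj₁ refl)  () (inj₂ (inj₂ (refl , refl)))
even-overlap (suc zero)    _                 (inj₂ refl)  () (inj₁ (refl , refl))
even-overlap (suc zero)    _                 (inj₂ refl)  () (inj₂ (inj₁ (refl , refl)))
even-overlap (suc zero)    _                 (inj₂ refl)  () (inj₂ (inj₂ (refl , refl)))
even-overlap (suc (suc r)) (s≤s (s≤s ()))    _            _  _

odd-overlap : ∀ {x y z} r → r < 2 → (x ≡ 0 ⊎ x ≡ 3) → (x + (r + r)) % 4 ≡ (y + z) % 4 →
  y ≡ 3 × z ≡ 3 → r ≡ 1
odd-overlap zero          _              (inj₁ refl) () (refl , refl)
odd-overlap zero          _              (inj₂ refl) () (refl , refl)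
odd-overlap (suc zero)    _              _           _  _             = refl
odd-overlap (suc (suc r)) (s≤s (s≤s ())) _           _  _

parity-from-types : ∀ d c c′ t → (d % 4 ≡ 0 ⊎ d % 4 ≡ 3) → d + (t + t) ≡ c + c′ →
  (((c % 4 ≡ 0 × c′ % 4 ≡ 0) ⊎ (c % 4 ≡ 0 × c′ % 4 ≡ 3) ⊎ (c % 4 ≡ 3 × c′ % 4 ≡ 0)) → t % 2 ≡ 0)
  × ((c % 4 ≡ 3 × c′ % 4 ≡ 3) → t % 2 ≡ 1)
parity-from-types d c c′ t d-type d+2t≡c+c′ =
  even-overlap (t % 2) (m%n<n t 2) d-type residues , odd-overlap (t % 2) (m%n<n t 2) d-type residues
  where
  open ≡-Reasoning
  residues : (d % 4 + (t % 2 + t % 2)) % 4 ≡ (c % 4 + c′ % 4) % 4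
  residues = begin
    (d % 4 + (t % 2 + t % 2)) % 4         ≡⟨ Modulo.%-+-%ʳ 3 (d % 4) (t % 2 + t % 2) ⟨
    (d % 4 + (t % 2 + t % 2) % 4) % 4     ≡⟨ cong (λ x → (d % 4 + x) % 4) ([m+m]%4≡[r+r]%4 t) ⟨
    (d % 4 + (t + t) % 4) % 4             ≡⟨ %-distribˡ-+ d (t + t) 4 ⟨
    (d + (t + t)) % 4                     ≡⟨ cong (_% 4) d+2t≡c+c′ ⟩
    (c + c′) % 4                          ≡⟨ %-distribˡ-+ c c′ 4 ⟩
    (c % 4 + c′ % 4) % 4                  ∎

theorem10 : ∀ {n} (G : Graph n) → Eps03 G → (C C' : Cycle G) (t : ℕ) → 0 < t →
    IntersectionIsPath C C' t →
    (((type C ≡ 0 × type C' ≡ 0) ⊎ (type C ≡ 0 × type C' ≡ 3) ⊎ (type C ≡ 3 × type C' ≡ 0)) → t % 2 ≡ 0)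
    × ((type C ≡ 3 × type C' ≡ 3) → t % 2 ≡ 1)
theorem10 G (_ , types-0-or-3 , _ , _) C C' t 0<t meet =
  parity-from-types (len D) (len C) (len C') t (types-0-or-3 D) len-D
  where
  D : Cycle G
  D = proj₁ (symmetric-difference-cycle C C' 0<t meet)
  len-D : len D + (t + t) ≡ len C + len C'
  len-D = proj₂ (symmetric-difference-cycle C C' 0<t meet)
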